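{- Let $G$ be a connected simple $4$-regular graph with $n$ vertices, and let $S$ be an oriented special spine whose singularity graph is $G$ and which has the minimal number of two-dimensional cells among all oriented special spines with singularity graph $G$. Then every edge of $G$ belongs to at most $2$ distinct two-dimensional cells of $S$.
   Context: A special spine is a finite connected two-dimensional cell complex such that the regular neighbourhood of each point is homeomorphic to an open disc, to a "book with 3 pages" (a neighbourhood of an inner point of an edge), or to the cone over the $1$-skeleton of a tetrahedron (a neighbourhood of a vertex); each vertex is incident to $4$ edges and each edge to three two-dimensional cells (with multiplicities), and the two-dimensional cells (components of the complement of the singular set) are open discs. The singularity graph of the spine is the union of its vertices and edges (the points without disc neighbourhoods); it is a $4$-regular graph. A special spine is oriented (orientable) if it can be embedded in an oriented $3$-manifold (with an orientation fixed). Each two-dimensional cell is attached along a closed curve (its boundary line) running through the singularity graph; an edge $e$ belongs to a cell $f$ if the boundary of $f$ passes along $e$. A simple graph means a connected graph without loops and multiple edges. -}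

module Defs where

open import Data.Nat using (ℕ; _<ᵇ_; _%_; _≤_)
open import Data.Nat.ListAction using (sum)
open import Data.Fin using (Fin; toℕ)
open import Data.List using (map; allFin)
open import Data.Bool using (Bool; true; false; if_then_else_; _∧_; not; _xor_)
open import Data.Nat using (_≡ᵇ_)
open import Data.Product using (Σ; _×_; _,_; proj₁; proj₂; ∃-syntax)
open import Data.Sum using (_⊎_)
open import Data.Fin.Permutation using (Permutation′; _⟨$⟩ʳ_)
open import Relation.Binary.PropositionalEquality using (_≡_; _≢_)
open import Relation.Binary.Construct.Closure.Equivalence using (EqClosure)
open import Function.Definitions using (Surjective)

-- Vertices are Fin n; every vertex v has four ports (half-edges) Fin 4.
-- A dart (v , i) is the half-edge at v with port i; `opp` sends a dart to
-- the dart at the other end of the same edge.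

Dart : ℕ → Set
Dart n = Fin n × Fin 4

record Graph4 (n : ℕ) : Set where
  field
    opp       : Dart n → Dart n
    opp-invol : ∀ d → opp (opp d) ≡ d
    loopless  : ∀ v i → proj₁ (opp (v , i)) ≢ v
    no-multi  : ∀ v i i' → proj₁ (opp (v , i)) ≡ proj₁ (opp (v , i')) → i ≡ i'

  Adj : Fin n → Fin n → Set
  Adj u w = ∃[ i ] proj₁ (opp (u , i)) ≡ w

  Connected : Set
  Connected = ∀ u w → EqClosure Adj u w

open Graph4 public

-- At a vertex v the neighbourhood is the cone over the 1-skeleton of a
-- tetrahedron whose four vertices are the four half-edges (ports) at v;
-- its six "wings" are the unordered pairs {i , k} of distinct ports.
-- Along the edge with darts d = (v , i) and opp d = (w , j) the three pages
-- are glued by a bijection between the ports ≠ i at v and the ports ≠ j at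
-- w, encoded as a permutation π d of Fin 4 with π d i = j; the wing {i , k}
-- at v is continued by the wing {j , π d k} at w.  The 2-cells are obtained
-- by attaching one disc to every boundary circle of the resulting
-- neighbourhood of the singular graph.

record Spine {n : ℕ} (G : Graph4 n) : Set where
  field
    glue     : Dart n → Permutation′ 4
    glue-end : ∀ d → glue d ⟨$⟩ʳ proj₂ d ≡ proj₂ (opp G d)
    glue-opp : ∀ d k → glue (opp G d) ⟨$⟩ʳ (glue d ⟨$⟩ʳ k) ≡ k

open Spine public

inversions : (Fin 4 → Fin 4) → ℕ
inversions f = sum (map (λ a → sum (map (λ b →
  if (toℕ a <ᵇ toℕ b) ∧ (toℕ (f b) <ᵇ toℕ (f a)) then 1 else 0) (allFin 4))) (allFin 4))

isOdd : Permutation′ 4 → Bool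
isOdd π = (inversions (π ⟨$⟩ʳ_) % 2) ≡ᵇ 1

-- Orientability: there is a choice of orientation ε v of the standard
-- vertex chart at each vertex (true = the labelling of the tetrahedron by
-- ports 0,1,2,3 is positively oriented) such that every edge gluing
-- reverses the cyclic order of pages w.r.t. the two charts; this amounts to:
-- glue d is odd iff the two endpoint charts have the same orientation.
Orientable : {n : ℕ} {G : Graph4 n} → Spine G → Set
Orientable {n} {G} S =
  Σ (Fin n → Bool) λ ε → ∀ d →
    isOdd (glue S d) ≡ not (ε (proj₁ d) xor ε (proj₁ (opp G d)))

-- Corners: a vertex v together with an ordered pair of distinct ports;
-- (v , i , k) and (v , k , i) represent the same wing {i , k} at v.
Corner : ℕ → Set
Corner n = Σ (Fin n × Fin 4 × Fin 4) λ { (v , i , k) → i ≢ k }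

data Step {n : ℕ} {G : Graph4 n} (S : Spine G) : Corner n → Corner n → Set where
  flip  : ∀ v i k p q → Step S ((v , i , k) , p) ((v , k , i) , q)
  cross : ∀ v i k p q →
          Step S ((v , i , k) , p)
                 ((proj₁ (opp G (v , i)) , proj₂ (opp G (v , i)) , glue S (v , i) ⟨$⟩ʳ k) , q)

SameCell : {n : ℕ} {G : Graph4 n} → Spine G → Corner n → Corner n → Set
SameCell S = EqClosure (Step S)

HasCells : {n : ℕ} {G : Graph4 n} → Spine G → ℕ → Set
HasCells {n} S c =
  Σ (Corner n → Fin c) λ f →
    Surjective _≡_ _≡_ f ×
    (∀ x y → (f x ≡ f y → SameCell S x y) × (SameCell S x y → f x ≡ f y))

MinimalOriented : {n : ℕ} {G : Graph4 n} → Spine G → Set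
MinimalOriented {n} {G} S =
  Orientable S × Σ ℕ λ c → HasCells S c ×
    (∀ (S' : Spine G) c' → Orientable S' → HasCells S' c' → c ≤ c')

-- the wing x contains a strip along the edge of dart d
-- (x is a wing at one end of the edge and has that half-edge as a side)
OnEdge : {n : ℕ} (G : Graph4 n) → Dart n → Corner n → Set
OnEdge G d ((v , i , k) , _) = ((v , i) ≡ d) ⊎ ((v , i) ≡ opp G d)

AtMostTwoCells : {n : ℕ} {G : Graph4 n} → Spine G → Dart n → Set
AtMostTwoCells {n} {G} S d =
  Σ (Corner n) λ a → Σ (Corner n) λ b →
    ∀ x → OnEdge G d x → SameCell S x a ⊎ SameCell S x b

{-# OPTIONS --safe #-}
module Submission where

-- If the three wings (pages) along an edge lay in three distinct 2-cells,
-- reglue the edge by the 3-cycle of its wings.  Following the old boundary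
-- curves shows that the three cells fuse into one while every other cell
-- survives, so the new spine has two cells fewer; and since a 3-cycle is an
-- even permutation the new spine is still orientable, contradicting minimality.

open import Defs
open import Data.Bool using (Bool; not; _xor_)
import Data.Bool.Properties as Bool
open import Data.Empty using (⊥-elim)
open import Data.Fin using (Fin; toℕ; punchIn; punchOut)
open import Data.Fin.Patterns using (0F; 1F; 2F; 3F)
open import Data.Fin.Permutation using (Permutation′; permutation; _⟨$⟩ʳ_; _∘ₚ_)
import Data.Fin.Permutation as Perm
open import Data.Fin.Properties
  using ( _≟_; all?; pigeonhole; injective⇒≤; *↔×; punchInᵢ≢i; punchIn-punchOut; punchOut-punchIn
        ; punchOut-cong; punchOut-injective)
open import Data.Nat using (ℕ; zero; suc; _+_; _*_; _<_; _%_; _≡ᵇ_; s≤s)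
open import Data.Nat.GeneralisedArithmetic using (fold; fold-+; iterate-is-fold)
open import Data.Nat.Properties using (n<1+n; m<n⇒m<1+n; m≤n⇒∃[o]m+o≡n; +-suc; <⇒≱)
open import Data.Product using (_×_; _,_; proj₁; proj₂; ∃-syntax; map₂)
open import Data.Product.Function.NonDependent.Propositional using (_×-↔_)
open import Data.Product.Properties using (≡-dec)
open import Data.Sum using (_⊎_; inj₁; inj₂; fromInj₁)
import Data.Sum as Sum
open import Function.Base using (_∘_)
open import Function.Bundles using (Injection; _↣_)
import Function.Construct.Composition as Composition
open import Function.Definitions using (Injective; Surjective)
open import Function.Properties.Inverse using (↔-refl; ↔-sym; ↔-trans; ↔⇒↣)
open import Relation.Binary.Construct.Closure.Equivalence using (return; symmetric; gfold)
open import Relation.Binary.Construct.Closure.ReflexiveTransitive using (ε; _◅_; _◅◅_)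
open import Relation.Binary.Construct.Closure.Symmetric using (SymClosure; fwd; bwd)
open import Relation.Binary.Definitions using (DecidableEquality)
open import Relation.Binary.PropositionalEquality
  using (_≡_; _≢_; refl; sym; trans; cong; cong₂; subst; isEquivalence; module ≡-Reasoning)
open import Relation.Nullary using (Dec; yes; no; ¬_; contradiction)
open import Relation.Nullary.Decidable using (from-yes; map′; _→-dec_; _×-dec_; _⊎-dec_)

-- Parity of permutations of Fin 4

next : Fin 3 → Fin 3
next 0F = 1F
next 1F = 2F
next 2F = 0F

-- The 3-cycle of the three ports other than i, taken in increasing order.
rotate : Fin 4 → Fin 4 → Fin 4
rotate 0F 0F = 0F
rotate 0F 1F = 2F
rotate 0F 2F = 3F
rotate 0F 3F = 1F
rotate 1F 0F = 2F
rotate 1F 1F = 1F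
rotate 1F 2F = 3F
rotate 1F 3F = 0F
rotate 2F 0F = 1F
rotate 2F 1F = 3F
rotate 2F 2F = 2F
rotate 2F 3F = 0F
rotate 3F 0F = 1F
rotate 3F 1F = 2F
rotate 3F 2F = 0F
rotate 3F 3F = 3F

rotate-fixes : ∀ i → rotate i i ≡ i
rotate-fixes = from-yes (all? λ i → rotate i i ≟ i)

rotate-punchIn : ∀ i t → rotate i (punchIn i t) ≡ punchIn i (next t)
rotate-punchIn = from-yes (all? λ i → all? λ t → rotate i (punchIn i t) ≟ punchIn i (next t))

rotate³ : ∀ i k → rotate i (rotate i (rotate i k)) ≡ k
rotate³ = from-yes (all? λ i → all? λ k → rotate i (rotate i (rotate i k)) ≟ k)

rotation : Fin 4 → Permutation′ 4
rotation i = permutation (rotate i) (rotate i ∘ rotate i) (rotate³ i) (rotate³ i)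

table : Fin 4 → Fin 4 → Fin 4 → Fin 4 → Fin 4 → Fin 4
table a b c e 0F = a
table a b c e 1F = b
table a b c e 2F = c
table a b c e 3F = e

oddInversions : (Fin 4 → Fin 4) → Bool
oddInversions f = (inversions f % 2) ≡ᵇ 1

-- The inversion count only inspects the four values of f, so parity facts
-- about injective maps reduce to a finite check over value tables.
rotations-preserve-parity : ∀ i a b c e →
  (∀ x y → table a b c e x ≡ table a b c e y → x ≡ y) →
  oddInversions (table a b c e ∘ rotate i) ≡ oddInversions (table a b c e) ×
  oddInversions (rotate i ∘ table a b c e) ≡ oddInversions (table a b c e)
rotations-preserve-parity = from-yes
  (all? λ i → all? λ a → all? λ b → all? λ c → all? λ e →
    (all? λ x → all? λ y → (table a b c e x ≟ table a b c e y) →-dec (x ≟ y)) →-dec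
    ((oddInversions (table a b c e ∘ rotate i) Bool.≟ oddInversions (table a b c e)) ×-dec
     (oddInversions (rotate i ∘ table a b c e) Bool.≟ oddInversions (table a b c e))))

module _ (f : Fin 4 → Fin 4) (f-injective : Injective _≡_ _≡_ f) where

  private
    values : Fin 4 → Fin 4
    values = table (f 0F) (f 1F) (f 2F) (f 3F)

    values≗f : ∀ x → values x ≡ f x
    values≗f 0F = refl
    values≗f 1F = refl
    values≗f 2F = refl
    values≗f 3F = refl

    values-injective : ∀ x y → values x ≡ values y → x ≡ y
    values-injective x y eq rewrite values≗f x | values≗f y = f-injective eq

  oddInversions-∘-rotate : ∀ i → oddInversions (f ∘ rotate i) ≡ oddInversions f
  oddInversions-∘-rotate 0F = proj₁ (rotations-preserve-parity 0F _ _ _ _ values-injective)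
  oddInversions-∘-rotate 1F = proj₁ (rotations-preserve-parity 1F _ _ _ _ values-injective)
  oddInversions-∘-rotate 2F = proj₁ (rotations-preserve-parity 2F _ _ _ _ values-injective)
  oddInversions-∘-rotate 3F = proj₁ (rotations-preserve-parity 3F _ _ _ _ values-injective)

  oddInversions-rotate-∘ : ∀ i → oddInversions (rotate i ∘ f) ≡ oddInversions f
  oddInversions-rotate-∘ i = proj₂ (rotations-preserve-parity i _ _ _ _ values-injective)

⟨$⟩ʳ-injective : ∀ {m} (π : Permutation′ m) → Injective _≡_ _≡_ (π ⟨$⟩ʳ_)
⟨$⟩ʳ-injective π = Injection.injective (↔⇒↣ π)

isOdd-rotation-∘ₚ : ∀ i π → isOdd (rotation i ∘ₚ π) ≡ isOdd π
isOdd-rotation-∘ₚ i π = oddInversions-∘-rotate (π ⟨$⟩ʳ_) (⟨$⟩ʳ-injective π) i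

isOdd-∘ₚ-flip-rotation : ∀ i π → isOdd (π ∘ₚ Perm.flip (rotation i)) ≡ isOdd π
isOdd-∘ₚ-flip-rotation i π = trans
  (oddInversions-rotate-∘ (rotate i ∘ (π ⟨$⟩ʳ_)) (⟨$⟩ʳ-injective (π ∘ₚ rotation i)) i)
  (oddInversions-rotate-∘ (π ⟨$⟩ʳ_) (⟨$⟩ʳ-injective π) i)

-- Orbits of injective maps on finite sets

module _ {A : Set} {m : ℕ} (encode : A ↣ Fin m) {f : A → A} (f-injective : Injective _≡_ _≡_ f) where

  fold-injective : ∀ t → Injective _≡_ _≡_ (λ x → fold x f t)
  fold-injective zero    eq = eq
  fold-injective (suc t) eq = fold-injective t (f-injective eq)

  fold-periodic : ∀ x → ∃[ q ] fold x f (suc q) ≡ x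
  fold-periodic x
    with a , b , a<b , same ← pigeonhole (n<1+n m) (λ t → Injection.to encode (fold x f (toℕ t)))
    with q , a+1+q≡b ← m≤n⇒∃[o]m+o≡n a<b
    = q , sym (fold-injective (toℕ a) (begin
      fold x f (toℕ a)                   ≡⟨ Injection.injective encode same ⟩
      fold x f (toℕ b)                   ≡⟨ cong (fold x f) (trans (+-suc (toℕ a) q) a+1+q≡b) ⟨
      fold x f (toℕ a + suc q)           ≡⟨ fold-+ x f (toℕ a) ⟩
      fold (fold x f (suc q)) f (toℕ a)  ∎))
    where open ≡-Reasoning

-- Identifying points of Fin c

module _ {m} {a b : Fin (suc m)} (a≢b : a ≢ b) where

  merge : Fin (suc m) → Fin m
  merge x with x ≟ b
  ... | yes _   = punchOut (a≢b ∘ sym)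
  ... | no x≢b  = punchOut (x≢b ∘ sym)

  merge-identifies : merge a ≡ merge b
  merge-identifies with a ≟ b | b ≟ b
  ... | yes a≡b | _       = contradiction a≡b a≢b
  ... | no _    | no b≢b  = contradiction refl b≢b
  ... | no _    | yes _   = punchOut-cong b refl

  merge-punchIn : ∀ z → merge (punchIn b z) ≡ z
  merge-punchIn z with punchIn b z ≟ b
  ... | yes eq = contradiction eq (punchInᵢ≢i b z)
  ... | no _   = trans (punchOut-cong b refl) (punchOut-punchIn b)

  merge-surjective : Surjective _≡_ _≡_ merge
  merge-surjective z = punchIn b z , λ { refl → merge-punchIn z }

  merge-kernel : ∀ x y → merge x ≡ merge y →
                 x ≡ y ⊎ ((x ≡ a ⊎ x ≡ b) × (y ≡ a ⊎ y ≡ b))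
  merge-kernel x y eq with x ≟ b | y ≟ b
  ... | yes x≡b | yes y≡b = inj₁ (trans x≡b (sym y≡b))
  ... | yes x≡b | no y≢b  =
    inj₂ (inj₂ x≡b , inj₁ (sym (punchOut-injective (a≢b ∘ sym) (y≢b ∘ sym) eq)))
  ... | no x≢b  | yes y≡b =
    inj₂ (inj₁ (punchOut-injective (x≢b ∘ sym) (a≢b ∘ sym) eq) , inj₂ y≡b)
  ... | no x≢b  | no y≢b  = inj₁ (punchOut-injective (x≢b ∘ sym) (y≢b ∘ sym) eq)

record Collapse {c : ℕ} (y : Fin 3 → Fin c) : Set where
  field
    c′         : ℕ
    c′<c       : c′ < c
    collapse   : Fin c → Fin c′
    surjective : Surjective _≡_ _≡_ collapse
    identifies : ∀ t u → collapse (y t) ≡ collapse (y u)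
    kernel     : ∀ x x′ → collapse x ≡ collapse x′ →
                 x ≡ x′ ⊎ (∃[ t ] x ≡ y t) × (∃[ t ] x′ ≡ y t)

collapse-image : ∀ {c} (y : Fin 3 → Fin c) → Injective _≡_ _≡_ y → Collapse y
collapse-image {zero}        y y-injective = contradiction (injective⇒≤ y-injective) λ ()
collapse-image {suc zero}    y y-injective = contradiction (injective⇒≤ y-injective) λ { (s≤s ()) }
collapse-image {suc (suc c)} y y-injective = record
  { c′         = c
  ; c′<c       = m<n⇒m<1+n (n<1+n c)
  ; collapse   = h₂ ∘ h₁
  ; surjective = Composition.surjective _≡_ _≡_ _≡_
                   (merge-surjective y₀≢y₁) (merge-surjective h₁y₀≢h₁y₂)
  ; identifies = λ t u → trans (to-y₀ t) (sym (to-y₀ u))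
  ; kernel     = kernel
  }
  where
  y₀≢y₁ : y 0F ≢ y 1F
  y₀≢y₁ eq with () ← y-injective eq

  h₁ = merge y₀≢y₁

  h₁y₀≢h₁y₂ : h₁ (y 0F) ≢ h₁ (y 2F)
  h₁y₀≢h₁y₂ eq with merge-kernel y₀≢y₁ (y 0F) (y 2F) eq
  ... | inj₁ y₀≡y₂             with () ← y-injective y₀≡y₂
  ... | inj₂ (_ , inj₁ y₂≡y₀) with () ← y-injective y₂≡y₀
  ... | inj₂ (_ , inj₂ y₂≡y₁) with () ← y-injective y₂≡y₁

  h₂ = merge h₁y₀≢h₁y₂

  to-y₀ : ∀ t → h₂ (h₁ (y t)) ≡ h₂ (h₁ (y 0F))
  to-y₀ 0F = refl
  to-y₀ 1F = cong h₂ (sym (merge-identifies y₀≢y₁))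
  to-y₀ 2F = sym (merge-identifies h₁y₀≢h₁y₂)

  from₀₁ : ∀ {x} → x ≡ y 0F ⊎ x ≡ y 1F → ∃[ t ] x ≡ y t
  from₀₁ (inj₁ eq) = 0F , eq
  from₀₁ (inj₂ eq) = 1F , eq

  from₀₂ : ∀ {x} → h₁ x ≡ h₁ (y 0F) ⊎ h₁ x ≡ h₁ (y 2F) → ∃[ t ] x ≡ y t
  from₀₂ {x} (inj₁ eq) with merge-kernel y₀≢y₁ x (y 0F) eq
  ... | inj₁ x≡y₀       = 0F , x≡y₀
  ... | inj₂ (x∈ , _)   = from₀₁ x∈
  from₀₂ {x} (inj₂ eq) with merge-kernel y₀≢y₁ x (y 2F) eq
  ... | inj₁ x≡y₂       = 2F , x≡y₂
  ... | inj₂ (x∈ , _)   = from₀₁ x∈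

  kernel : ∀ x x′ → h₂ (h₁ x) ≡ h₂ (h₁ x′) →
           x ≡ x′ ⊎ (∃[ t ] x ≡ y t) × (∃[ t ] x′ ≡ y t)
  kernel x x′ eq with merge-kernel h₁y₀≢h₁y₂ (h₁ x) (h₁ x′) eq
  ... | inj₂ (x∈ , x′∈) = inj₂ (from₀₂ x∈ , from₀₂ x′∈)
  ... | inj₁ eq₁ with merge-kernel y₀≢y₁ x x′ eq₁
  ...   | inj₁ x≡x′       = inj₁ x≡x′
  ...   | inj₂ (x∈ , x′∈) = inj₂ (from₀₁ x∈ , from₀₁ x′∈)

-- Boundary walks of the 2-cells

RawCorner : ℕ → Set
RawCorner n = Fin n × Fin 4 × Fin 4

module _ {n : ℕ} where

  rawCorner↣Fin : RawCorner n ↣ Fin (n * (4 * 4))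
  rawCorner↣Fin = ↔⇒↣ (↔-trans (↔-refl ×-↔ ↔-sym *↔×) (↔-sym *↔×))

  swapʳ : RawCorner n → RawCorner n
  swapʳ (v , i , k) = v , k , i

  swap : Corner n → Corner n
  swap (r , i≢k) = swapʳ r , i≢k ∘ sym

  module _ {G : Graph4 n} (T : Spine G) where

    swap-step : ∀ x → Step T x (swap x)
    swap-step ((v , i , k) , i≢k) = flip v i k i≢k (i≢k ∘ sym)

    sameCell-raw : ∀ {x y} → proj₁ x ≡ proj₁ y → SameCell T x y
    sameCell-raw {(v , i , k) , i≢k} {_ , i≢k′} refl =
      return (flip v i k i≢k (i≢k ∘ sym)) ◅◅ return (flip v k i (i≢k ∘ sym) i≢k′)

module FaceWalk {n : ℕ} {G : Graph4 n} (S : Spine G) where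

  acrossʳ : RawCorner n → RawCorner n
  acrossʳ (v , i , k) = proj₁ (opp G (v , i)) , proj₂ (opp G (v , i)) , glue S (v , i) ⟨$⟩ʳ k

  across : Corner n → Corner n
  across ((v , i , k) , i≢k) =
    acrossʳ (v , i , k) , i≢k ∘ ⟨$⟩ʳ-injective (glue S (v , i)) ∘ trans (glue-end S (v , i))

  across-step : ∀ x → Step S x (across x)
  across-step ((v , i , k) , i≢k) = cross v i k i≢k _

  acrossʳ-involutive : ∀ r → acrossʳ (acrossʳ r) ≡ r
  acrossʳ-involutive (v , i , k) =
    cong₂ (λ (w , j) k′ → w , j , k′) (opp-invol G (v , i)) (glue-opp S (v , i) k)

  acrossʳ-injective : Injective _≡_ _≡_ acrossʳ
  acrossʳ-injective {r} {r′} eq =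
    trans (sym (acrossʳ-involutive r)) (trans (cong acrossʳ eq) (acrossʳ-involutive r′))

  walkʳ : RawCorner n → RawCorner n
  walkʳ = acrossʳ ∘ swapʳ

  walk : Corner n → Corner n
  walk = across ∘ swap

  walks : ℕ → Corner n → Corner n
  walks t c = fold c walk t

  walks-sameCell : ∀ t c → SameCell S c (walks t c)
  walks-sameCell zero    c = ε
  walks-sameCell (suc t) c = walks-sameCell t c ◅◅ return (swap-step S _) ◅◅ return (across-step _)

  walks-suc′ : ∀ t c → walks (suc t) c ≡ walks t (walk c)
  walks-suc′ t c = trans (iterate-is-fold c walk (suc t)) (sym (iterate-is-fold (walk c) walk t))

  walks-raw : ∀ t c → proj₁ (walks t c) ≡ fold (proj₁ c) walkʳ t
  walks-raw zero    c = refl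
  walks-raw (suc t) c = cong walkʳ (walks-raw t c)

  walkʳ-injective : Injective _≡_ _≡_ walkʳ
  walkʳ-injective = cong swapʳ ∘ acrossʳ-injective

  walks-periodic : ∀ c → ∃[ q ] proj₁ (walks (suc q) c) ≡ proj₁ c
  walks-periodic c with q , period ← fold-periodic rawCorner↣Fin walkʳ-injective (proj₁ c) =
    q , trans (walks-raw (suc q) c) period

  -- Walking t steps and then swapping is an involution; each pair of extra
  -- steps conjugates it by a step, so a fixed point would lead back to a
  -- fixed point of swap (t even) or of across (t odd).
  swap-walks-no-fixed-point : ∀ t c → proj₁ (swap (walks t c)) ≢ proj₁ c
  swap-walks-no-fixed-point zero          ((v , i , k) , i≢k) eq = i≢k (sym (cong (proj₁ ∘ proj₂) eq))
  swap-walks-no-fixed-point (suc zero)    ((v , i , k) , i≢k) eq = loopless G v k (cong proj₁ eq)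
  swap-walks-no-fixed-point (suc (suc t)) c eq = swap-walks-no-fixed-point t (walk c) (begin
    proj₁ (swap (walks t (walk c)))                 ≡⟨ cong (proj₁ ∘ swap) (walks-suc′ t c) ⟨
    proj₁ (swap (walks (suc t) c))                  ≡⟨ acrossʳ-involutive _ ⟨
    walkʳ (proj₁ (swap (walks (suc (suc t)) c)))    ≡⟨ cong walkʳ eq ⟩
    walkʳ (proj₁ c)                                 ∎)
    where open ≡-Reasoning

-- Rewiring an edge

_≟ᵈ_ : ∀ {n} → DecidableEquality (Dart n)
_≟ᵈ_ = ≡-dec _≟_ _≟_

opp-transpose : ∀ {n} (G : Graph4 n) {e e′} → opp G e ≡ e′ → e ≡ opp G e′
opp-transpose G {e} eq = trans (sym (opp-invol G e)) (cong (opp G) eq)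

module EdgeCorners {n : ℕ} {G : Graph4 n} (v : Fin n) (i : Fin 4) where

  d : Dart n
  d = v , i

  wing : Fin 3 → Corner n
  wing t = (v , i , punchIn i t) , punchInᵢ≢i i t ∘ sym

  dartOf : Corner n → Dart n
  dartOf ((w , j , _) , _) = w , j

  onEdge? : ∀ x → Dec (OnEdge G d x)
  onEdge? x = (dartOf x ≟ᵈ d) ⊎-dec (dartOf x ≟ᵈ opp G d)

  at-wing : ∀ x → dartOf x ≡ d → ∃[ t ] proj₁ x ≡ proj₁ (wing t)
  at-wing ((_ , _ , k) , i≢k) refl = punchOut i≢k , cong (λ k → v , i , k) (sym (punchIn-punchOut i≢k))

  module _ (T : Spine G) where
    open FaceWalk T

    onEdge-across : ∀ x → OnEdge G d x → OnEdge G d (across x)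
    onEdge-across _ (inj₁ eq) = inj₂ (cong (opp G) eq)
    onEdge-across _ (inj₂ eq) = inj₁ (trans (cong (opp G) eq) (opp-invol G d))

    onEdge-wing : ∀ x → OnEdge G d x →
                  ∃[ t ] (proj₁ x ≡ proj₁ (wing t) ⊎ proj₁ (across x) ≡ proj₁ (wing t))
    onEdge-wing x (inj₁ eq) = map₂ inj₁ (at-wing x eq)
    onEdge-wing x (inj₂ eq) = map₂ inj₂ (at-wing (across x) (trans (cong (opp G) eq) (opp-invol G d)))

    sameCell-up-to-across : ∀ {x y} → proj₁ x ≡ proj₁ y ⊎ proj₁ (across x) ≡ proj₁ y →
                            SameCell T x y
    sameCell-up-to-across (inj₁ eq) = sameCell-raw T eq
    sameCell-up-to-across (inj₂ eq) = return (across-step _) ◅◅ sameCell-raw T eq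

    onEdge-sameCell-wing : ∀ x → OnEdge G d x → ∃[ t ] SameCell T x (wing t)
    onEdge-sameCell-wing x on = map₂ sameCell-up-to-across (onEdge-wing x on)

    WingsInDistinctCells : Set
    WingsInDistinctCells = ∀ t u → SameCell T (wing t) (wing u) → t ≡ u

    sameCell? : ∀ {c} → HasCells T c → ∀ x y → Dec (SameCell T x y)
    sameCell? (f , _ , f-cells) x y = map′ (proj₁ (f-cells x y)) (proj₂ (f-cells x y)) (f x ≟ f y)

    wings-in-two-cells : ∀ a b → (∀ t → SameCell T (wing t) a ⊎ SameCell T (wing t) b) →
                         AtMostTwoCells T d
    wings-in-two-cells a b wing-in = a , b , λ x on →
      let t , x~t = onEdge-sameCell-wing x on in Sum.map (x~t ◅◅_) (x~t ◅◅_) (wing-in t)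

    two-cells-or-distinct : ∀ {c} → HasCells T c → AtMostTwoCells T d ⊎ WingsInDistinctCells
    two-cells-or-distinct cells
      with sameCell? cells (wing 0F) (wing 1F)
         | sameCell? cells (wing 0F) (wing 2F)
         | sameCell? cells (wing 1F) (wing 2F)
    ... | yes 0~1 | _ | _ = inj₁ (wings-in-two-cells (wing 0F) (wing 2F)
          λ { 0F → inj₁ ε ; 1F → inj₁ (symmetric _ 0~1) ; 2F → inj₂ ε })
    ... | no _ | yes 0~2 | _ = inj₁ (wings-in-two-cells (wing 0F) (wing 1F)
          λ { 0F → inj₁ ε ; 1F → inj₂ ε ; 2F → inj₁ (symmetric _ 0~2) })
    ... | no _ | no _ | yes 1~2 = inj₁ (wings-in-two-cells (wing 0F) (wing 1F)
          λ { 0F → inj₁ ε ; 1F → inj₂ ε ; 2F → inj₂ (symmetric _ 1~2) })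
    ... | no 0≁1 | no 0≁2 | no 1≁2 = inj₂ distinct
      where
      distinct : WingsInDistinctCells
      distinct 0F 0F _   = refl
      distinct 1F 1F _   = refl
      distinct 2F 2F _   = refl
      distinct 0F 1F 0~1 = contradiction 0~1 0≁1
      distinct 0F 2F 0~2 = contradiction 0~2 0≁2
      distinct 1F 2F 1~2 = contradiction 1~2 1≁2
      distinct 1F 0F 1~0 = contradiction (symmetric _ 1~0) 0≁1
      distinct 2F 0F 2~0 = contradiction (symmetric _ 2~0) 0≁2
      distinct 2F 1F 2~1 = contradiction (symmetric _ 2~1) 1≁2

module Rewiring {n : ℕ} {G : Graph4 n} (S : Spine G) (v : Fin n) (i : Fin 4) where

  open EdgeCorners {G = G} v i public
  open FaceWalk S

  data Site (e : Dart n) : Set where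
    at-d      : e ≡ d → Site e
    at-d̄      : e ≡ opp G d → Site e
    elsewhere : e ≢ d → e ≢ opp G d → Site e

  site : ∀ e → Site e
  site e with e ≟ᵈ d | e ≟ᵈ opp G d
  ... | yes e≡d | _       = at-d e≡d
  ... | no _    | yes e≡d̄ = at-d̄ e≡d̄
  ... | no e≢d  | no e≢d̄  = elsewhere e≢d e≢d̄

  d≢d̄ : d ≢ opp G d
  d≢d̄ eq = loopless G v i (sym (cong proj₁ eq))

  -- Each wing of d is now continued across the edge where the next wing used to be.
  rewiredGlue : Dart n → Permutation′ 4
  rewiredGlue e with site e
  ... | at-d _        = rotation i ∘ₚ glue S d
  ... | at-d̄ _        = glue S (opp G d) ∘ₚ Perm.flip (rotation i)
  ... | elsewhere _ _ = glue S e

  rewiredGlue-d : ∀ {e} → e ≡ d → ∀ k → rewiredGlue e ⟨$⟩ʳ k ≡ glue S d ⟨$⟩ʳ rotate i k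
  rewiredGlue-d {e} e≡d k with site e
  ... | at-d _          = refl
  ... | at-d̄ e≡d̄        = contradiction (trans (sym e≡d) e≡d̄) d≢d̄
  ... | elsewhere e≢d _ = contradiction e≡d e≢d

  rewiredGlue-d̄ : ∀ {e} → e ≡ opp G d → ∀ k →
                  rewiredGlue e ⟨$⟩ʳ k ≡ rotate i (rotate i (glue S (opp G d) ⟨$⟩ʳ k))
  rewiredGlue-d̄ {e} e≡d̄ k with site e
  ... | at-d e≡d        = contradiction (trans (sym e≡d) e≡d̄) d≢d̄
  ... | at-d̄ _          = refl
  ... | elsewhere _ e≢d̄ = contradiction e≡d̄ e≢d̄

  rewiredGlue-elsewhere : ∀ {e} → e ≢ d → e ≢ opp G d → ∀ k →
                          rewiredGlue e ⟨$⟩ʳ k ≡ glue S e ⟨$⟩ʳ k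
  rewiredGlue-elsewhere {e} e≢d e≢d̄ k with site e
  ... | at-d e≡d        = contradiction e≡d e≢d
  ... | at-d̄ e≡d̄        = contradiction e≡d̄ e≢d̄
  ... | elsewhere _ _   = refl

  rewiredGlue-end : ∀ e → rewiredGlue e ⟨$⟩ʳ proj₂ e ≡ proj₂ (opp G e)
  rewiredGlue-end e with site e
  ... | at-d refl = trans (cong (glue S d ⟨$⟩ʳ_) (rotate-fixes i)) (glue-end S d)
  ... | at-d̄ refl = begin
    rotate i (rotate i (glue S (opp G d) ⟨$⟩ʳ proj₂ (opp G d)))
      ≡⟨ cong (rotate i ∘ rotate i) (glue-end S (opp G d)) ⟩
    rotate i (rotate i (proj₂ (opp G (opp G d))))
      ≡⟨ rotate²-fixes (cong proj₂ (opp-invol G d)) ⟩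
    proj₂ (opp G (opp G d)) ∎
    where
    open ≡-Reasoning
    rotate²-fixes : ∀ {k} → k ≡ i → rotate i (rotate i k) ≡ k
    rotate²-fixes refl = trans (cong (rotate i) (rotate-fixes i)) (rotate-fixes i)
  ... | elsewhere _ _ = glue-end S e

  rewiredGlue-opp : ∀ e k → rewiredGlue (opp G e) ⟨$⟩ʳ (rewiredGlue e ⟨$⟩ʳ k) ≡ k
  rewiredGlue-opp e k with site e
  ... | at-d refl = begin
    rewiredGlue (opp G d) ⟨$⟩ʳ (glue S d ⟨$⟩ʳ rotate i k)
      ≡⟨ rewiredGlue-d̄ refl _ ⟩
    rotate i (rotate i (glue S (opp G d) ⟨$⟩ʳ (glue S d ⟨$⟩ʳ rotate i k)))
      ≡⟨ cong (rotate i ∘ rotate i) (glue-opp S d _) ⟩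
    rotate i (rotate i (rotate i k))
      ≡⟨ rotate³ i k ⟩
    k ∎
    where open ≡-Reasoning
  ... | at-d̄ refl = begin
    rewiredGlue (opp G (opp G d)) ⟨$⟩ʳ rotate i (rotate i (glue S (opp G d) ⟨$⟩ʳ k))
      ≡⟨ rewiredGlue-d (opp-invol G d) _ ⟩
    glue S d ⟨$⟩ʳ rotate i (rotate i (rotate i (glue S (opp G d) ⟨$⟩ʳ k)))
      ≡⟨ cong (glue S d ⟨$⟩ʳ_) (rotate³ i _) ⟩
    glue S d ⟨$⟩ʳ (glue S (opp G d) ⟨$⟩ʳ k)
      ≡⟨ subst (λ e → glue S e ⟨$⟩ʳ (glue S (opp G d) ⟨$⟩ʳ k) ≡ k) (opp-invol G d)
               (glue-opp S (opp G d) k) ⟩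
    k ∎
    where open ≡-Reasoning
  ... | elsewhere e≢d e≢d̄ =
    trans (rewiredGlue-elsewhere (e≢d̄ ∘ opp-transpose G) (e≢d ∘ opp-opp-transpose) _) (glue-opp S e k)
    where
    opp-opp-transpose : opp G e ≡ opp G d → e ≡ d
    opp-opp-transpose eq = trans (opp-transpose G eq) (opp-invol G d)

  rewired : Spine G
  rewired = record { glue = rewiredGlue ; glue-end = rewiredGlue-end ; glue-opp = rewiredGlue-opp }

  rewired-orientable : Orientable S → Orientable rewired
  rewired-orientable (orient , parity) = orient , parity′
    where
    parity′ : ∀ e → isOdd (rewiredGlue e) ≡ not (orient (proj₁ e) xor orient (proj₁ (opp G e)))
    parity′ e with site e
    ... | at-d refl       = trans (isOdd-rotation-∘ₚ i (glue S d)) (parity d)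
    ... | at-d̄ refl       = trans (isOdd-∘ₚ-flip-rotation i (glue S (opp G d))) (parity (opp G d))
    ... | elsewhere _ _   = parity e

  module Rewired = FaceWalk rewired

  across-off-edge : ∀ x → ¬ OnEdge G d x → proj₁ (Rewired.across x) ≡ proj₁ (across x)
  across-off-edge ((w , j , k) , _) off =
    cong (λ k′ → _ , _ , k′) (rewiredGlue-elsewhere (off ∘ inj₁) (off ∘ inj₂) k)

  step-off-edge : ∀ {x y} → ¬ OnEdge G d x → SymClosure (Step S) x y → SameCell rewired x y
  step-off-edge _   (fwd (flip w j k p q))  = return (flip w j k p q)
  step-off-edge _   (bwd (flip w j k p q))  = bwd (flip w j k p q) ◅ ε
  step-off-edge off (fwd (cross w j k p q)) =
    return (Rewired.across-step _) ◅◅ sameCell-raw rewired (across-off-edge ((w , j , k) , p) off)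
  step-off-edge off (bwd (cross w j k p q)) = symmetric _
    (return (Rewired.across-step _) ◅◅ sameCell-raw rewired (across-off-edge x (off ∘ onEdge-across S x)))
    where x = ((w , j , k) , p)

  stay-or-meet-edge : ∀ {x y} → SameCell S x y →
                      SameCell rewired x y ⊎ ∃[ z ] OnEdge G d z × SameCell rewired x z
  stay-or-meet-edge ε = inj₁ ε
  stay-or-meet-edge {x} (s ◅ x′~y) with onEdge? x
  ... | yes on = inj₂ (x , on , ε)
  ... | no off with stay-or-meet-edge x′~y
  ...   | inj₁ x′~y′           = inj₁ (step-off-edge off s ◅◅ x′~y′)
  ...   | inj₂ (z , on , x′~z) = inj₂ (z , on , step-off-edge off s ◅◅ x′~z)

  walk-until-edge : ∀ b s → SameCell rewired b (walks s b) ⊎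
                    ∃[ t ] OnEdge G d (swap (walks t b)) × SameCell rewired b (swap (walks t b))
  walk-until-edge b zero = inj₁ ε
  walk-until-edge b (suc s) with walk-until-edge b s
  ... | inj₂ stopped = inj₂ stopped
  ... | inj₁ b~w with onEdge? (swap (walks s b))
  ...   | yes on = inj₂ (s , on , b~w ◅◅ return (swap-step rewired _))
  ...   | no off =
    inj₁ (b~w ◅◅ return (swap-step rewired _) ◅◅ step-off-edge off (fwd (across-step _)))

  module _ (distinct : WingsInDistinctCells S) where

    onEdge-in-wing-cell : ∀ x u → OnEdge G d x → SameCell S x (wing u) →
                          proj₁ x ≡ proj₁ (wing u) ⊎ proj₁ (across x) ≡ proj₁ (wing u)
    onEdge-in-wing-cell x u on x~u with t , x≈t ← onEdge-wing S x on
      with refl ← distinct t u (symmetric _ (sameCell-up-to-across S x≈t) ◅◅ x~u) = x≈t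

    -- Walk the boundary of the old cell of wing u starting on the far side of
    -- the edge; it returns to wing u and, the cells being distinct, meets the
    -- edge nowhere else, so none of its steps is changed by the rewiring.
    across-wing-connected : ∀ u → SameCell rewired (across (wing u)) (wing u)
    across-wing-connected u = go (walks-periodic b)
      where
      a b : Corner n
      a = wing u
      b = across a
      go : ∃[ q ] proj₁ (walks (suc q) b) ≡ proj₁ b → SameCell rewired b a
      go (q , period) with walk-until-edge b q
      ... | inj₁ b~w =
        b~w ◅◅ return (swap-step rewired _) ◅◅ sameCell-raw rewired (acrossʳ-injective period)
      ... | inj₂ (t , on , b~z)
            with onEdge-in-wing-cell (swap (walks t b)) u on (symmetric _
                   (return (across-step a) ◅◅ walks-sameCell t b ◅◅ return (swap-step S _)))
      ...   | inj₁ z≈a = b~z ◅◅ sameCell-raw rewired z≈a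
      ...   | inj₂ z̄≈a = contradiction (trans (sym (acrossʳ-involutive _)) (cong acrossʳ z̄≈a))
                                       (swap-walks-no-fixed-point t b)

    wing-next-connected : ∀ t → SameCell rewired (wing t) (wing (next t))
    wing-next-connected t =
      return (Rewired.across-step (wing t)) ◅◅
      sameCell-raw rewired (cong (λ k → _ , _ , k)
        (trans (rewiredGlue-d refl _) (cong (glue S d ⟨$⟩ʳ_) (rotate-punchIn i t)))) ◅◅
      across-wing-connected (next t)

    wings-connected : ∀ t u → SameCell rewired (wing t) (wing u)
    wings-connected t u = to-first t ◅◅ symmetric _ (to-first u)
      where
      to-first : ∀ t → SameCell rewired (wing t) (wing 0F)
      to-first 0F = ε
      to-first 1F = wing-next-connected 1F ◅◅ wing-next-connected 2F
      to-first 2F = wing-next-connected 2F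

    onEdge-connected : ∀ x y → OnEdge G d x → OnEdge G d y → SameCell rewired x y
    onEdge-connected x y x-on y-on
      with t , x~t ← onEdge-sameCell-wing rewired x x-on
         | u , y~u ← onEdge-sameCell-wing rewired y y-on
      = x~t ◅◅ wings-connected t u ◅◅ symmetric _ y~u

    sameCell-rewired : ∀ {x y} → SameCell S x y → SameCell rewired x y
    sameCell-rewired x~y with stay-or-meet-edge x~y | stay-or-meet-edge (symmetric _ x~y)
    ... | inj₁ x~′y | _         = x~′y
    ... | inj₂ _    | inj₁ y~′x = symmetric _ y~′x
    ... | inj₂ (z , z-on , x~z) | inj₂ (z′ , z′-on , y~z′) =
      x~z ◅◅ onEdge-connected z z′ z-on z′-on ◅◅ symmetric _ y~z′

    rewired-fewer-cells : ∀ {c} → HasCells S c → ∃[ c′ ] c′ < c × HasCells rewired c′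
    rewired-fewer-cells {c} (f , f-surjective , f-cells) =
      c′ , c′<c , collapse ∘ f , Composition.surjective _≡_ _≡_ _≡_ f-surjective surjective ,
      λ x y → same-label⇒sameCell x y , gfold isEquivalence (collapse ∘ f) step-keeps-label
      where
      wingCell : Fin 3 → Fin c
      wingCell t = f (wing t)

      wingCell-injective : Injective _≡_ _≡_ wingCell
      wingCell-injective {t} {u} eq = distinct t u (proj₁ (f-cells (wing t) (wing u)) eq)

      open Collapse (collapse-image wingCell wingCell-injective)

      same-label⇒sameCell : ∀ x y → collapse (f x) ≡ collapse (f y) → SameCell rewired x y
      same-label⇒sameCell x y eq with kernel (f x) (f y) eq
      ... | inj₁ fx≡fy = sameCell-rewired (proj₁ (f-cells x y) fx≡fy)
      ... | inj₂ ((t , fx≡) , (u , fy≡)) =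
        sameCell-rewired (proj₁ (f-cells x _) fx≡) ◅◅ wings-connected t u ◅◅
        symmetric _ (sameCell-rewired (proj₁ (f-cells y _) fy≡))

      onEdge-label : ∀ z → OnEdge G d z → collapse (f z) ≡ collapse (wingCell 0F)
      onEdge-label z on with t , z~t ← onEdge-sameCell-wing S z on =
        trans (cong collapse (proj₂ (f-cells _ _) z~t)) (identifies t 0F)

      step-keeps-label : ∀ {x y} → Step rewired x y → collapse (f x) ≡ collapse (f y)
      step-keeps-label (flip w j k p q) = cong collapse (proj₂ (f-cells _ _) (return (flip w j k p q)))
      step-keeps-label (cross w j k p q) with onEdge? ((w , j , k) , p)
      ... | yes on = trans (onEdge-label _ on)
                       (sym (onEdge-label _ (onEdge-across rewired ((w , j , k) , p) on)))
      ... | no off = cong collapse (proj₂ (f-cells _ _) (return (across-step _) ◅◅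
                       sameCell-raw S (sym (across-off-edge ((w , j , k) , p) off))))

lemma1 : (n : ℕ) (G : Graph4 n) → Connected G →
         (S : Spine G) → MinimalOriented S →
         ∀ (d : Dart n) → AtMostTwoCells S d
lemma1 n G _ S (orientable , c , cells , minimal) (v , i) =
  fromInj₁ (⊥-elim ∘ wings-not-distinct) (two-cells-or-distinct S cells)
  where
  open Rewiring S v i
  wings-not-distinct : ¬ WingsInDistinctCells S
  wings-not-distinct distinct =
    let c′ , c′<c , cells′ = rewired-fewer-cells distinct cells
    in <⇒≱ c′<c (minimal rewired c′ (rewired-orientable orientable) cells′)
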